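{- For any $k\ge2$ and $0\le a\le k-1$, the lower-triangular array $D^{k,a}$ whose $(n,m)$-entry is $D^{k,a}_{n,m}$ ($0\le m\le n$) is a proper Riordan array with $A$-sequence and $Z$-sequence $$A(t)=(1+t)^k,\qquad Z(t)=\frac{(1+t)^k-(1+t)^{k-a-1}}{t}.$$
   Context: For $k\ge2$ and $a\ge0$, a generalized $k$-Dyck path of depth $a$, semilength $n$ and semiheight $m$ is an integer lattice path from $(0,0)$ to $(kn,km)$ using steps $U=(1,1)$ and $D_{k-1}=(1,1-k)$ that stays weakly above the line $y=-a$; $D^{k,a}_{n,m}$ is the number of such paths. A proper Riordan array $\mathcal R(d(t),h(t))$, for formal power series with $d(0)\ne0$, $h(0)=0$, $h'(0)\neq 0$, is the lower-triangular array with $(i,j)$-entry $d_{i,j}=[t^i]\,d(t)h(t)^j$. Power series $A(t)=\sum a_rt^r$ and $Z(t)=\sum z_rt^r$ are its $A$-sequence and $Z$-sequence if for all $i\ge1$: $d_{i,j}=\sum_{r\ge0}a_r d_{i-1,j-1+r}$ for $j\ge1$ and $d_{i,0}=\sum_{r\ge0} z_r d_{i-1,r}$. -}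

module Defs where

open import Data.Nat as ℕ using (ℕ; zero; suc; _∸_)
open import Data.Integer as ℤ using (ℤ; +_; 0ℤ; 1ℤ; _≤ᵇ_)
open import Data.Bool using (Bool; true; false; _∧_)
open import Data.List using (List; []; _∷_; map; _++_; filterᵇ; length)
open import Relation.Binary.PropositionalEquality using (_≡_; _≢_)
open import Data.Product using (_×_)

data Step : Set where
  U  : Step
  Dk : Step

δ : ℕ → Step → ℤ
δ k U  = 1ℤ
δ k Dk = 1ℤ ℤ.- (+ k)

allSeqs : ℕ → List (List Step)
allSeqs zero    = [] ∷ []
allSeqs (suc L) = map (U ∷_) (allSeqs L) ++ map (Dk ∷_) (allSeqs L)

validFrom : ℕ → ℕ → ℤ → ℤ → List Step → Bool
validFrom k a y Y []       = (y ≤ᵇ Y) ∧ (Y ≤ᵇ y)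
validFrom k a y Y (s ∷ ss) =
  (ℤ.- (+ a) ≤ᵇ (y ℤ.+ δ k s)) ∧ validFrom k a (y ℤ.+ δ k s) Y ss

-- D^{k,a}_{n,m}: number of lattice paths from (0,0) to (kn,km) with
-- steps U, D_{k-1}, staying weakly above y = -a
-- (paths from (0,0) to (kn,km) have exactly kn steps; (0,0) itself is above -a)
Dyck : ℕ → ℕ → ℕ → ℕ → ℕ
Dyck k a n m =
  length (filterᵇ (validFrom k a 0ℤ (+ (k ℕ.* m))) (allSeqs (k ℕ.* n)))

FPS : Set
FPS = ℕ → ℤ

sumTo : ℕ → (ℕ → ℤ) → ℤ
sumTo zero    f = 0ℤ
sumTo (suc n) f = sumTo n f ℤ.+ f n

one : FPS
one zero    = 1ℤ
one (suc _) = 0ℤ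

onePlusT : FPS
onePlusT zero          = 1ℤ
onePlusT (suc zero)    = 1ℤ
onePlusT (suc (suc _)) = 0ℤ

_⊛_ : FPS → FPS → FPS
(f ⊛ g) n = sumTo (suc n) (λ i → f i ℤ.* g (n ∸ i))

_⊝_ : FPS → FPS → FPS
(f ⊝ g) n = f n ℤ.- g n

_^ˢ_ : FPS → ℕ → FPS
f ^ˢ zero  = one
f ^ˢ suc j = f ⊛ (f ^ˢ j)

riordan : FPS → FPS → ℕ → ℕ → ℤ
riordan d h i j = (d ⊛ (h ^ˢ j)) i

IsProper : FPS → FPS → Set
IsProper d h = (d 0 ≢ 0ℤ) × (h 0 ≡ 0ℤ) × (h 1 ≢ 0ℤ)

-- A-sequence: d_{i,j} = Σ_r a_r d_{i-1,j-1+r} for i ≥ 1, j ≥ 1.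
-- Written with i = i'+1, j = j'+1; the sum is truncated at r ≤ i'
-- since all further terms d_{i',j'+r} (j'+r > i') vanish by lower-triangularity.
IsASeq : (ℕ → ℕ → ℤ) → FPS → Set
IsASeq R A = ∀ i j → R (suc i) (suc j) ≡ sumTo (suc i) (λ r → A r ℤ.* R i (j ℕ.+ r))

-- Z-sequence: d_{i,0} = Σ_r z_r d_{i-1,r} for i ≥ 1 (same truncation).
IsZSeq : (ℕ → ℕ → ℤ) → FPS → Set
IsZSeq R Z = ∀ i → R (suc i) 0 ≡ sumTo (suc i) (λ r → Z r ℤ.* R i r)

Aseq : ℕ → FPS
Aseq k = onePlusT ^ˢ k

-- Z(t) = ((1+t)^k - (1+t)^{k-a-1}) / t   (numerator has zero constant term)
Zseq : ℕ → ℕ → FPS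
Zseq k a r = ((onePlusT ^ˢ k) ⊝ (onePlusT ^ˢ (k ∸ a ∸ 1))) (suc r)

-- Shift heights so that the floor is 0 and the paths start at height a.  Counted by
-- their last step, the walks reaching height Y after one more step number
-- ψ (Y − 1) + ψ (Y + k − 1), where ψ counts the shorter walks by endpoint (the first
-- term absent at Y = 0).  Far from the floor, k such steps produce the binomial
-- transform, so D_{n+1,m+1} = Σ_r C(k,r) D_{n,m+r}: this is the A-sequence (1+t)^k.
-- The first column ends at height a < k, where the missing terms leave
-- Σ_{j ≤ a} C(k−a−1+j, s), and the hockey-stick identity turns this into the
-- coefficients of ((1+t)^k − (1+t)^{k−a−1})/t.  Finally, an array with an
-- A-sequence A is the Riordan array R(d,h) with d its first column and h the solution
-- of h = t A(h), obtained as the limit of the iteration h ↦ t A(h).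

module Submission where

open import Defs
open import Data.Nat using (ℕ; _≤_; _∸_)
open import Data.Integer using (+_)
open import Data.Product using (Σ; _×_)
open import Relation.Binary.PropositionalEquality using (_≡_)

import Algebra.Properties.CommutativeSemigroup as CommSemigroupProperties
open import Data.Bool using (Bool; true; false; T; _∧_; if_then_else_)
open import Data.Bool.Properties using (T-∧)
open import Data.Empty using (⊥-elim)
open import Data.Integer as ℤ using (ℤ; 0ℤ; 1ℤ)
import Data.Integer.Properties as ℤₚ
open import Data.Integer.Tactic.RingSolver using (solve-∀)
open import Data.List using (List; []; _∷_; map; _++_; filterᵇ; length)
open import Data.List.Properties using (filter-++; length-++)
open import Data.Nat using (zero; suc; _+_; _*_; _<_; _≟_; _≤ᵇ_; _≤′_; ≤′-refl; ≤′-step; z≤n; s≤s)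
open import Data.Nat.GeneralisedArithmetic using (fold)
import Data.Nat.Properties as ℕₚ
open import Data.Product using (_,_)
open import Function using (_∘_)
open import Function.Bundles using (Equivalence)
open import Relation.Binary.PropositionalEquality
  using (_≢_; refl; sym; trans; cong; cong₂; subst; subst₂; _≗_; module ≡-Reasoning)
open import Relation.Nullary using (yes; no; does)
open import Relation.Nullary.Decidable using (dec-true; dec-false; T?)

module ℕ+ = CommSemigroupProperties ℕₚ.+-commutativeSemigroup
module ℤ+ = CommSemigroupProperties ℤₚ.+-commutativeSemigroup
open ≡-Reasoning

-- Finite sums

sumTo-cong : ∀ n {f g : ℕ → ℤ} → (∀ i → i < n → f i ≡ g i) → sumTo n f ≡ sumTo n g
sumTo-cong zero    f≡g = refl
sumTo-cong (suc n) f≡g =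
  cong₂ ℤ._+_ (sumTo-cong n (λ i i<n → f≡g i (ℕₚ.m<n⇒m<1+n i<n))) (f≡g n ℕₚ.≤-refl)

sumTo-zero : ∀ n {f : ℕ → ℤ} → (∀ i → i < n → f i ≡ 0ℤ) → sumTo n f ≡ 0ℤ
sumTo-zero zero    f≡0 = refl
sumTo-zero (suc n) f≡0 =
  cong₂ ℤ._+_ (sumTo-zero n (λ i i<n → f≡0 i (ℕₚ.m<n⇒m<1+n i<n))) (f≡0 n ℕₚ.≤-refl)

sumTo-+ : ∀ n (f g : ℕ → ℤ) → sumTo n (λ i → f i ℤ.+ g i) ≡ sumTo n f ℤ.+ sumTo n g
sumTo-+ zero    f g = refl
sumTo-+ (suc n) f g = trans (cong (ℤ._+ (f n ℤ.+ g n)) (sumTo-+ n f g))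
                            (ℤ+.interchange (sumTo n f) (sumTo n g) (f n) (g n))

sumTo-*ˡ : ∀ n c (f : ℕ → ℤ) → c ℤ.* sumTo n f ≡ sumTo n (λ i → c ℤ.* f i)
sumTo-*ˡ zero    c f = ℤₚ.*-zeroʳ c
sumTo-*ˡ (suc n) c f = trans (ℤₚ.*-distribˡ-+ c (sumTo n f) (f n))
                             (cong (ℤ._+ c ℤ.* f n) (sumTo-*ˡ n c f))

sumTo-*ʳ : ∀ n c (f : ℕ → ℤ) → sumTo n f ℤ.* c ≡ sumTo n (λ i → f i ℤ.* c)
sumTo-*ʳ n c f = begin
  sumTo n f ℤ.* c                ≡⟨ ℤₚ.*-comm (sumTo n f) c ⟩
  c ℤ.* sumTo n f                ≡⟨ sumTo-*ˡ n c f ⟩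
  sumTo n (λ i → c ℤ.* f i)      ≡⟨ sumTo-cong n (λ i _ → ℤₚ.*-comm c (f i)) ⟩
  sumTo n (λ i → f i ℤ.* c)      ∎

sumTo-uncons : ∀ n (f : ℕ → ℤ) → sumTo (suc n) f ≡ f 0 ℤ.+ sumTo n (f ∘ suc)
sumTo-uncons zero    f = ℤₚ.+-comm 0ℤ (f 0)
sumTo-uncons (suc n) f = trans (cong (ℤ._+ f (suc n)) (sumTo-uncons n f))
                               (ℤₚ.+-assoc (f 0) (sumTo n (f ∘ suc)) (f (suc n)))

sumTo-truncate : ∀ {m n} (f : ℕ → ℤ) → m ≤ n → (∀ i → m ≤ i → i < n → f i ≡ 0ℤ) →
                 sumTo n f ≡ sumTo m f
sumTo-truncate {m} f m≤n = go (ℕₚ.≤⇒≤′ m≤n)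
  where
  go : ∀ {n} → m ≤′ n → (∀ i → m ≤ i → i < n → f i ≡ 0ℤ) → sumTo n f ≡ sumTo m f
  go ≤′-refl               _      = refl
  go (≤′-step {n} m≤′n) f≡0 =
    trans (cong₂ ℤ._+_ (go m≤′n (λ i m≤i i<n → f≡0 i m≤i (ℕₚ.m<n⇒m<1+n i<n)))
                       (f≡0 n (ℕₚ.≤′⇒≤ m≤′n) ℕₚ.≤-refl))
          (ℤₚ.+-identityʳ (sumTo m f))

sumTo-swap : ∀ m n (F : ℕ → ℕ → ℤ) →
             sumTo m (λ i → sumTo n (F i)) ≡ sumTo n (λ j → sumTo m (λ i → F i j))
sumTo-swap zero    n F = sym (sumTo-zero n (λ _ _ → refl))
sumTo-swap (suc m) n F = trans (cong (ℤ._+ sumTo n (F m)) (sumTo-swap m n F))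
                               (sym (sumTo-+ n (λ j → sumTo m (λ i → F i j)) (F m)))

sumTo-reverse : ∀ n (f : ℕ → ℤ) → sumTo (suc n) f ≡ sumTo (suc n) (λ i → f (n ∸ i))
sumTo-reverse zero    f = refl
sumTo-reverse (suc n) f = begin
  sumTo (suc n) f ℤ.+ f (suc n)                        ≡⟨ cong (ℤ._+ f (suc n)) (sumTo-reverse n f) ⟩
  sumTo (suc n) (λ i → f (n ∸ i)) ℤ.+ f (suc n)        ≡⟨ ℤₚ.+-comm _ (f (suc n)) ⟩
  f (suc n) ℤ.+ sumTo (suc n) (λ i → f (n ∸ i))        ≡⟨ sym (sumTo-uncons (suc n) (λ i → f (suc n ∸ i))) ⟩
  sumTo (suc (suc n)) (λ i → f (suc n ∸ i))            ∎

sumTo-triangle : ∀ n (F : ℕ → ℕ → ℤ) →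
  sumTo n (λ i → sumTo (suc i) (F i)) ≡ sumTo n (λ j → sumTo (n ∸ j) (λ l → F (j + l) j))
sumTo-triangle zero    F = refl
sumTo-triangle (suc n) F = begin
  sumTo n (λ i → sumTo (suc i) (F i)) ℤ.+ sumTo (suc n) (F n)
    ≡⟨ cong (ℤ._+ sumTo (suc n) (F n)) (trans (sumTo-triangle n F) (sym lastColumnEmpty)) ⟩
  sumTo (suc n) (λ j → sumTo (n ∸ j) (λ l → F (j + l) j)) ℤ.+ sumTo (suc n) (F n)
    ≡⟨ sym (sumTo-+ (suc n) _ _) ⟩
  sumTo (suc n) (λ j → sumTo (n ∸ j) (λ l → F (j + l) j) ℤ.+ F n j)
    ≡⟨ sumTo-cong (suc n) (λ j j<1+n → extendRow j (ℕₚ.≤-pred j<1+n)) ⟩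
  sumTo (suc n) (λ j → sumTo (suc n ∸ j) (λ l → F (j + l) j)) ∎
  where
  lastColumnEmpty : sumTo (suc n) (λ j → sumTo (n ∸ j) (λ l → F (j + l) j))
                  ≡ sumTo n (λ j → sumTo (n ∸ j) (λ l → F (j + l) j))
  lastColumnEmpty = trans (cong (λ x → S ℤ.+ sumTo x (λ l → F (n + l) n)) (ℕₚ.n∸n≡0 n))
                          (ℤₚ.+-identityʳ S)
    where S = sumTo n (λ j → sumTo (n ∸ j) (λ l → F (j + l) j))
  extendRow : ∀ j → j ≤ n →
    sumTo (n ∸ j) (λ l → F (j + l) j) ℤ.+ F n j ≡ sumTo (suc n ∸ j) (λ l → F (j + l) j)
  extendRow j j≤n rewrite ℕₚ.+-∸-assoc 1 j≤n =
    cong (λ x → sumTo (n ∸ j) (λ l → F (j + l) j) ℤ.+ F x j) (sym (ℕₚ.m+[n∸m]≡n j≤n))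

-- Formal power series

⊛-congˡ : ∀ {f f′} g → f ≗ f′ → f ⊛ g ≗ f′ ⊛ g
⊛-congˡ g f≗f′ n = sumTo-cong (suc n) (λ i _ → cong (ℤ._* g (n ∸ i)) (f≗f′ i))

⊛-congʳ : ∀ f {g g′} → g ≗ g′ → f ⊛ g ≗ f ⊛ g′
⊛-congʳ f g≗g′ n = sumTo-cong (suc n) (λ i _ → cong (f i ℤ.*_) (g≗g′ (n ∸ i)))

⊛-comm : ∀ f g → f ⊛ g ≗ g ⊛ f
⊛-comm f g n = trans (sumTo-reverse n (λ i → f i ℤ.* g (n ∸ i)))
  (sumTo-cong (suc n) (λ i i<1+n →
    trans (cong (λ j → f (n ∸ i) ℤ.* g j) (ℕₚ.m∸[m∸n]≡n (ℕₚ.≤-pred i<1+n)))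
          (ℤₚ.*-comm (f (n ∸ i)) (g i))))

⊛-identityˡ : ∀ g → one ⊛ g ≗ g
⊛-identityˡ g n = begin
  (one ⊛ g) n                                                ≡⟨ sumTo-uncons n _ ⟩
  1ℤ ℤ.* g n ℤ.+ sumTo n (λ i → 0ℤ ℤ.* g (n ∸ suc i))        ≡⟨ cong₂ ℤ._+_ (ℤₚ.*-identityˡ (g n))
                                                                 (sumTo-zero n (λ i _ → ℤₚ.*-zeroˡ (g (n ∸ suc i)))) ⟩
  g n ℤ.+ 0ℤ                                                 ≡⟨ ℤₚ.+-identityʳ (g n) ⟩
  g n                                                        ∎

⊛-identityʳ : ∀ g → g ⊛ one ≗ g
⊛-identityʳ g n = trans (⊛-comm g one n) (⊛-identityˡ g n)

⊛-assoc : ∀ f g h → (f ⊛ g) ⊛ h ≗ f ⊛ (g ⊛ h)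
⊛-assoc f g h n = begin
  sumTo (suc n) (λ i → sumTo (suc i) (λ j → f j ℤ.* g (i ∸ j)) ℤ.* h (n ∸ i))
    ≡⟨ sumTo-cong (suc n) (λ i _ → sumTo-*ʳ (suc i) (h (n ∸ i)) _) ⟩
  sumTo (suc n) (λ i → sumTo (suc i) (λ j → f j ℤ.* g (i ∸ j) ℤ.* h (n ∸ i)))
    ≡⟨ sumTo-triangle (suc n) _ ⟩
  sumTo (suc n) (λ j → sumTo (suc n ∸ j) (λ l → f j ℤ.* g (j + l ∸ j) ℤ.* h (n ∸ (j + l))))
    ≡⟨ sumTo-cong (suc n) (λ j j<1+n → inner j (ℕₚ.≤-pred j<1+n)) ⟩
  sumTo (suc n) (λ j → f j ℤ.* sumTo (suc (n ∸ j)) (λ l → g l ℤ.* h (n ∸ j ∸ l)))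
    ∎
  where
  inner : ∀ j → j ≤ n →
    sumTo (suc n ∸ j) (λ l → f j ℤ.* g (j + l ∸ j) ℤ.* h (n ∸ (j + l)))
    ≡ f j ℤ.* sumTo (suc (n ∸ j)) (λ l → g l ℤ.* h (n ∸ j ∸ l))
  inner j j≤n rewrite ℕₚ.+-∸-assoc 1 j≤n =
    trans (sumTo-cong (suc (n ∸ j)) (λ l _ →
             trans (cong₂ (λ x y → f j ℤ.* g x ℤ.* h y) (ℕₚ.m+n∸m≡n j l) (sym (ℕₚ.∸-+-assoc n j l)))
                   (ℤₚ.*-assoc (f j) (g l) (h (n ∸ j ∸ l)))))
          (sym (sumTo-*ˡ (suc (n ∸ j)) (f j) _))

⊛-leftComm : ∀ f g h → f ⊛ (g ⊛ h) ≗ g ⊛ (f ⊛ h)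
⊛-leftComm f g h n = begin
  (f ⊛ (g ⊛ h)) n   ≡⟨ sym (⊛-assoc f g h n) ⟩
  ((f ⊛ g) ⊛ h) n   ≡⟨ ⊛-congˡ h (⊛-comm f g) n ⟩
  ((g ⊛ f) ⊛ h) n   ≡⟨ ⊛-assoc g f h n ⟩
  (g ⊛ (f ⊛ h)) n   ∎

^ˢ-+ : ∀ h r j → (h ^ˢ r) ⊛ (h ^ˢ j) ≗ h ^ˢ (r + j)
^ˢ-+ h zero    j = ⊛-identityˡ (h ^ˢ j)
^ˢ-+ h (suc r) j n = trans (⊛-assoc h (h ^ˢ r) (h ^ˢ j) n) (⊛-congʳ h (^ˢ-+ h r j) n)

EqBelow : ℕ → FPS → FPS → Set
EqBelow n f g = ∀ i → i < n → f i ≡ g i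

⊛-eqBelow : ∀ n {f f′ g g′} → EqBelow n f f′ → EqBelow n g g′ → EqBelow n (f ⊛ g) (f′ ⊛ g′)
⊛-eqBelow n f≡f′ g≡g′ i i<n = sumTo-cong (suc i) (λ j j<1+i →
  cong₂ ℤ._*_ (f≡f′ j (ℕₚ.≤-<-trans (ℕₚ.≤-pred j<1+i) i<n))
              (g≡g′ (i ∸ j) (ℕₚ.≤-<-trans (ℕₚ.m∸n≤m i j) i<n)))

^ˢ-eqBelow : ∀ n {f g} → EqBelow n f g → ∀ r → EqBelow n (f ^ˢ r) (g ^ˢ r)
^ˢ-eqBelow n f≡g zero    i _ = refl
^ˢ-eqBelow n f≡g (suc r) = ⊛-eqBelow n f≡g (^ˢ-eqBelow n f≡g r)

VanishesBelow : ℕ → FPS → Set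
VanishesBelow n f = ∀ i → i < n → f i ≡ 0ℤ

⊛-vanishesBelow : ∀ p q {f g} → VanishesBelow p f → VanishesBelow q g → VanishesBelow (p + q) (f ⊛ g)
⊛-vanishesBelow p q {f} {g} f≡0 g≡0 n n<p+q = sumTo-zero (suc n) term
  where
  term : ∀ i → i < suc n → f i ℤ.* g (n ∸ i) ≡ 0ℤ
  term i i<1+n with i ℕₚ.<? p
  ... | yes i<p = trans (cong (ℤ._* g (n ∸ i)) (f≡0 i i<p)) (ℤₚ.*-zeroˡ (g (n ∸ i)))
  ... | no  i≮p = trans (cong (f i ℤ.*_) (g≡0 (n ∸ i) n∸i<q)) (ℤₚ.*-zeroʳ (f i))
    where
    n∸i<q : n ∸ i < q
    n∸i<q = ℕₚ.+-cancelˡ-< i (n ∸ i) q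
      (subst (_< i + q) (sym (ℕₚ.m+[n∸m]≡n (ℕₚ.≤-pred i<1+n)))
             (ℕₚ.<-≤-trans n<p+q (ℕₚ.+-monoˡ-≤ q (ℕₚ.≮⇒≥ i≮p))))

^ˢ-vanishesBelow : ∀ {h} → h 0 ≡ 0ℤ → ∀ r → VanishesBelow r (h ^ˢ r)
^ˢ-vanishesBelow h0≡0 zero    i ()
^ˢ-vanishesBelow {h} h0≡0 (suc r) =
  ⊛-vanishesBelow 1 r {h} {h ^ˢ r} (λ { zero _ → h0≡0 ; (suc _) (s≤s ()) }) (^ˢ-vanishesBelow h0≡0 r)

-- Riordan arrays with a given A-sequence

shift : FPS → FPS
shift f zero    = 0ℤ
shift f (suc n) = f n

shift-⊛ : ∀ f g n → (shift f ⊛ g) (suc n) ≡ (f ⊛ g) n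
shift-⊛ f g n = trans (sumTo-uncons (suc n) _)
                      (trans (cong (ℤ._+ (f ⊛ g) n) (ℤₚ.*-zeroˡ (g (suc n)))) (ℤₚ.+-identityˡ _))

-- A(h), truncated at r ≤ n: correct whenever h 0 = 0, since h^r then starts at t^r
_∘ˢ_ : FPS → FPS → FPS
(A ∘ˢ h) n = sumTo (suc n) (λ r → A r ℤ.* (h ^ˢ r) n)

∘ˢ-⊛ : ∀ A {h} → h 0 ≡ 0ℤ → ∀ g n →
       ((A ∘ˢ h) ⊛ g) n ≡ sumTo (suc n) (λ r → A r ℤ.* ((h ^ˢ r) ⊛ g) n)
∘ˢ-⊛ A {h} h0≡0 g n = begin
  sumTo (suc n) (λ p → sumTo (suc p) (λ r → A r ℤ.* (h ^ˢ r) p) ℤ.* g (n ∸ p))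
    ≡⟨ sumTo-cong (suc n) (λ p p<1+n → cong (ℤ._* g (n ∸ p)) (sym (allPowers p (ℕₚ.≤-pred p<1+n)))) ⟩
  sumTo (suc n) (λ p → sumTo (suc n) (λ r → A r ℤ.* (h ^ˢ r) p) ℤ.* g (n ∸ p))
    ≡⟨ sumTo-cong (suc n) (λ p _ → trans (sumTo-*ʳ (suc n) (g (n ∸ p)) _)
                                          (sumTo-cong (suc n) (λ r _ → ℤₚ.*-assoc (A r) _ _))) ⟩
  sumTo (suc n) (λ p → sumTo (suc n) (λ r → A r ℤ.* ((h ^ˢ r) p ℤ.* g (n ∸ p))))
    ≡⟨ sumTo-swap (suc n) (suc n) _ ⟩
  sumTo (suc n) (λ r → sumTo (suc n) (λ p → A r ℤ.* ((h ^ˢ r) p ℤ.* g (n ∸ p))))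
    ≡⟨ sumTo-cong (suc n) (λ r _ → sym (sumTo-*ˡ (suc n) (A r) _)) ⟩
  sumTo (suc n) (λ r → A r ℤ.* ((h ^ˢ r) ⊛ g) n)
    ∎
  where
  allPowers : ∀ p → p ≤ n →
    sumTo (suc n) (λ r → A r ℤ.* (h ^ˢ r) p) ≡ sumTo (suc p) (λ r → A r ℤ.* (h ^ˢ r) p)
  allPowers p p≤n = sumTo-truncate _ (s≤s p≤n) (λ r p<r _ →
    trans (cong (A r ℤ.*_) (^ˢ-vanishesBelow h0≡0 r p p<r)) (ℤₚ.*-zeroʳ (A r)))

module _ (Φ : FPS → FPS)
         (Φ-contracts : ∀ n {f g} → EqBelow n f g → EqBelow (suc n) (Φ f) (Φ g)) where
  private
    approx : ℕ → FPS
    approx zero    _ = 0ℤ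
    approx (suc N)   = Φ (approx N)

    approx-stable : ∀ n j → EqBelow n (approx n) (approx (n + j))
    approx-stable zero    j _ ()
    approx-stable (suc n) j = Φ-contracts n (approx-stable n j)

  fixpoint : FPS
  fixpoint i = approx (suc i) i

  fixpoint-unfold : fixpoint ≗ Φ fixpoint
  fixpoint-unfold i = Φ-contracts i approx≡fixpoint i ℕₚ.≤-refl
    where
    approx≡fixpoint : EqBelow i (approx i) fixpoint
    approx≡fixpoint j j<i = sym (trans (approx-stable (suc j) (i ∸ suc j) j ℕₚ.≤-refl)
                                       (cong (λ N → approx N j) (ℕₚ.m+[n∸m]≡n j<i)))

shift∘ˢ-contracts : ∀ A n {f g} → EqBelow n f g → EqBelow (suc n) (shift (A ∘ˢ f)) (shift (A ∘ˢ g))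
shift∘ˢ-contracts A n f≡g zero    _         = refl
shift∘ˢ-contracts A n f≡g (suc i) (s≤s i<n) =
  sumTo-cong (suc i) (λ r _ → cong (A r ℤ.*_) (^ˢ-eqBelow n f≡g r i i<n))

lagrange : FPS → FPS
lagrange A = fixpoint (λ h → shift (A ∘ˢ h)) (shift∘ˢ-contracts A)

lagrange-unfold : ∀ A → lagrange A ≗ shift (A ∘ˢ lagrange A)
lagrange-unfold A = fixpoint-unfold (λ h → shift (A ∘ˢ h)) (shift∘ˢ-contracts A)

riordan-ASeq : ∀ A d h → h ≗ shift (A ∘ˢ h) → IsASeq (riordan d h) A
riordan-ASeq A d h h≗tA[h] i j = begin
  (d ⊛ (h ⊛ (h ^ˢ j))) (suc i)                                ≡⟨ ⊛-leftComm d h (h ^ˢ j) (suc i) ⟩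
  (h ⊛ (d ⊛ (h ^ˢ j))) (suc i)                                ≡⟨ ⊛-congˡ (d ⊛ (h ^ˢ j)) h≗tA[h] (suc i) ⟩
  (shift (A ∘ˢ h) ⊛ (d ⊛ (h ^ˢ j))) (suc i)                   ≡⟨ shift-⊛ (A ∘ˢ h) (d ⊛ (h ^ˢ j)) i ⟩
  ((A ∘ˢ h) ⊛ (d ⊛ (h ^ˢ j))) i                               ≡⟨ ∘ˢ-⊛ A (h≗tA[h] 0) (d ⊛ (h ^ˢ j)) i ⟩
  sumTo (suc i) (λ r → A r ℤ.* ((h ^ˢ r) ⊛ (d ⊛ (h ^ˢ j))) i) ≡⟨ sumTo-cong (suc i) (λ r _ → cong (A r ℤ.*_) (mergePowers r)) ⟩
  sumTo (suc i) (λ r → A r ℤ.* riordan d h i (j + r))         ∎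
  where
  mergePowers : ∀ r → ((h ^ˢ r) ⊛ (d ⊛ (h ^ˢ j))) i ≡ (d ⊛ (h ^ˢ (j + r))) i
  mergePowers r = begin
    ((h ^ˢ r) ⊛ (d ⊛ (h ^ˢ j))) i   ≡⟨ ⊛-leftComm (h ^ˢ r) d (h ^ˢ j) i ⟩
    (d ⊛ ((h ^ˢ r) ⊛ (h ^ˢ j))) i   ≡⟨ ⊛-congʳ d (^ˢ-+ h r j) i ⟩
    (d ⊛ (h ^ˢ (r + j))) i          ≡⟨ cong (λ x → (d ⊛ (h ^ˢ x)) i) (ℕₚ.+-comm r j) ⟩
    (d ⊛ (h ^ˢ (j + r))) i          ∎

riordan-above-diagonal : ∀ d {h} → h 0 ≡ 0ℤ → ∀ {i j} → i < j → riordan d h i j ≡ 0ℤ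
riordan-above-diagonal d {h} h0≡0 {i} {j} =
  ⊛-vanishesBelow 0 j {d} {h ^ˢ j} (λ _ ()) (^ˢ-vanishesBelow {h} h0≡0 j) i

ASeq-unique : ∀ {R S : ℕ → ℕ → ℤ} A → IsASeq R A → IsASeq S A →
  (∀ n → R n 0 ≡ S n 0) → (∀ m → R 0 (suc m) ≡ S 0 (suc m)) → ∀ n m → R n m ≡ S n m
ASeq-unique A R-A S-A col row zero    zero    = col 0
ASeq-unique A R-A S-A col row zero    (suc m) = row m
ASeq-unique A R-A S-A col row (suc n) zero    = col (suc n)
ASeq-unique {R} {S} A R-A S-A col row (suc n) (suc m) =
  trans (R-A n m) (trans (sumTo-cong (suc n) (λ r _ →
    cong (A r ℤ.*_) (ASeq-unique {R} {S} A R-A S-A col row n (m + r)))) (sym (S-A n m)))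

-- Binomial coefficients

binomial : ℕ → ℕ → ℤ
binomial t = onePlusT ^ˢ t

binomial-zero : ∀ t → binomial t 0 ≡ 1ℤ
binomial-zero zero    = refl
binomial-zero (suc t) = trans (ℤₚ.+-identityˡ _) (trans (ℤₚ.*-identityˡ _) (binomial-zero t))

binomial-pascal : ∀ t s → binomial (suc t) (suc s) ≡ binomial t (suc s) ℤ.+ binomial t s
binomial-pascal t s = begin
  sumTo (suc (suc s)) (λ i → onePlusT i ℤ.* binomial t (suc s ∸ i))
    ≡⟨ sumTo-uncons (suc s) (λ i → onePlusT i ℤ.* binomial t (suc s ∸ i)) ⟩
  1ℤ ℤ.* binomial t (suc s) ℤ.+ sumTo (suc s) (λ i → onePlusT (suc i) ℤ.* binomial t (s ∸ i))
    ≡⟨ cong₂ ℤ._+_ (ℤₚ.*-identityˡ (binomial t (suc s))) (sumTo-uncons s (λ i → onePlusT (suc i) ℤ.* binomial t (s ∸ i))) ⟩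
  binomial t (suc s) ℤ.+ (1ℤ ℤ.* binomial t s ℤ.+ sumTo s (λ i → 0ℤ ℤ.* binomial t (s ∸ suc i)))
    ≡⟨ cong (ℤ._+_ (binomial t (suc s))) (cong₂ ℤ._+_ (ℤₚ.*-identityˡ (binomial t s)) (sumTo-zero s (λ i _ → ℤₚ.*-zeroˡ (binomial t (s ∸ suc i))))) ⟩
  binomial t (suc s) ℤ.+ (binomial t s ℤ.+ 0ℤ)
    ≡⟨ cong (ℤ._+_ (binomial t (suc s))) (ℤₚ.+-identityʳ _) ⟩
  binomial t (suc s) ℤ.+ binomial t s
    ∎

binomialSum : ℕ → (ℕ → ℕ) → ℕ
binomialSum zero    f = f 0
binomialSum (suc t) f = binomialSum t f + binomialSum t (f ∘ suc)

binomialSum-cong : ∀ t {f g} → f ≗ g → binomialSum t f ≡ binomialSum t g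
binomialSum-cong zero    f≗g = f≗g 0
binomialSum-cong (suc t) f≗g = cong₂ _+_ (binomialSum-cong t f≗g) (binomialSum-cong t (f≗g ∘ suc))

binomialSum-sumTo : ∀ t f N → t ≤ N → + binomialSum t f ≡ sumTo (suc N) (λ s → binomial t s ℤ.* + f s)
binomialSum-sumTo zero f N _ = sym (begin
  sumTo (suc N) (λ s → one s ℤ.* + f s)                       ≡⟨ sumTo-uncons N (λ s → one s ℤ.* + f s) ⟩
  1ℤ ℤ.* + f 0 ℤ.+ sumTo N (λ s → 0ℤ ℤ.* + f (suc s))         ≡⟨ cong₂ ℤ._+_ (ℤₚ.*-identityˡ (+ f 0))
                                                                 (sumTo-zero N (λ s _ → ℤₚ.*-zeroˡ (+ f (suc s)))) ⟩
  + f 0 ℤ.+ 0ℤ                                                ≡⟨ ℤₚ.+-identityʳ _ ⟩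
  + f 0                                                       ∎)
binomialSum-sumTo (suc t) f (suc N) (s≤s t≤N) = begin
  + (binomialSum t f + binomialSum t (f ∘ suc))
    ≡⟨ ℤₚ.pos-+ (binomialSum t f) (binomialSum t (f ∘ suc)) ⟩
  + binomialSum t f ℤ.+ + binomialSum t (f ∘ suc)
    ≡⟨ cong₂ ℤ._+_ (binomialSum-sumTo t f (suc N) (ℕₚ.m≤n⇒m≤1+n t≤N))
                   (binomialSum-sumTo t (f ∘ suc) N t≤N) ⟩
  sumTo (suc (suc N)) (term t) ℤ.+ sumTo (suc N) (λ s → binomial t s ℤ.* + f (suc s))
    ≡⟨ cong (ℤ._+ sumTo (suc N) (λ s → binomial t s ℤ.* + f (suc s))) (sumTo-uncons (suc N) (term t)) ⟩
  term t 0 ℤ.+ sumTo (suc N) (term t ∘ suc) ℤ.+ sumTo (suc N) (λ s → binomial t s ℤ.* + f (suc s))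
    ≡⟨ ℤₚ.+-assoc (term t 0) _ _ ⟩
  term t 0 ℤ.+ (sumTo (suc N) (term t ∘ suc) ℤ.+ sumTo (suc N) (λ s → binomial t s ℤ.* + f (suc s)))
    ≡⟨ cong₂ ℤ._+_ (cong (ℤ._* + f 0) (trans (binomial-zero t) (sym (binomial-zero (suc t)))))
                   (sym (trans (sumTo-cong (suc N) (λ s _ → pascalTerm s))
                              (sumTo-+ (suc N) (term t ∘ suc) (λ s → binomial t s ℤ.* + f (suc s))))) ⟩
  term (suc t) 0 ℤ.+ sumTo (suc N) (term (suc t) ∘ suc)
    ≡⟨ sym (sumTo-uncons (suc N) (term (suc t))) ⟩
  sumTo (suc (suc N)) (term (suc t))
    ∎
  where
  term : ℕ → ℕ → ℤ
  term t s = binomial t s ℤ.* + f s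
  pascalTerm : ∀ s → term (suc t) (suc s) ≡ term t (suc s) ℤ.+ binomial t s ℤ.* + f (suc s)
  pascalTerm s = trans (cong (ℤ._* + f (suc s)) (binomial-pascal t s))
                       (ℤₚ.*-distribʳ-+ (+ f (suc s)) (binomial t (suc s)) (binomial t s))

-- Walks on ℕ with steps +1 and −k′

delay : ℕ → (ℕ → ℕ) → ℕ → ℕ
delay zero    ψ y       = ψ y
delay (suc m) ψ zero    = 0
delay (suc m) ψ (suc y) = delay m ψ y

delay-cong : ∀ m {ψ φ} → ψ ≗ φ → delay m ψ ≗ delay m φ
delay-cong zero    ψ≗φ y       = ψ≗φ y
delay-cong (suc m) ψ≗φ zero    = refl
delay-cong (suc m) ψ≗φ (suc y) = delay-cong m ψ≗φ y

delay-+ : ∀ m ψ φ y → delay m (λ z → ψ z + φ z) y ≡ delay m ψ y + delay m φ y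
delay-+ zero    ψ φ y       = refl
delay-+ (suc m) ψ φ zero    = refl
delay-+ (suc m) ψ φ (suc y) = delay-+ m ψ φ y

delay-zero : ∀ m y → delay m (λ _ → 0) y ≡ 0
delay-zero zero    y       = refl
delay-zero (suc m) zero    = refl
delay-zero (suc m) (suc y) = delay-zero m y

module Walks (k′ : ℕ) where

  walks : ℕ → ℕ → ℕ → ℕ
  walks zero    y Y = if does (y ≟ Y) then 1 else 0
  walks (suc L) y Y = walks L (suc y) Y + delay k′ (λ z → walks L z Y) y

  -- if ψ Y′ counts the walks ending at Y′, then backStep ψ Y counts those extended by one step to Y
  backStep : (ℕ → ℕ) → ℕ → ℕ
  backStep ψ Y = delay 1 ψ Y + ψ (Y + k′)

  backStep-cong : ∀ {ψ φ} → ψ ≗ φ → backStep ψ ≗ backStep φ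
  backStep-cong ψ≗φ zero    = ψ≗φ k′
  backStep-cong ψ≗φ (suc Y) = cong₂ _+_ (ψ≗φ Y) (ψ≗φ (suc Y + k′))

  walks-zero-refl : ∀ y → walks 0 y y ≡ 1
  walks-zero-refl y = cong (λ b → if b then 1 else 0) (dec-true (y ≟ y) refl)

  walks-zero-< : ∀ {y Y} → y < Y → walks 0 y Y ≡ 0
  walks-zero-< {y} {Y} y<Y = cong (λ b → if b then 1 else 0) (dec-false (y ≟ Y) (ℕₚ.<⇒≢ y<Y))

  delay-walks-zero : ∀ m y Y → delay m (λ z → walks 0 z Y) y ≡ walks 0 y (Y + m)
  delay-walks-zero zero    y       Y rewrite ℕₚ.+-identityʳ Y = refl
  delay-walks-zero (suc m) zero    Y rewrite ℕₚ.+-suc Y m = refl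
  delay-walks-zero (suc m) (suc y) Y rewrite ℕₚ.+-suc Y m = delay-walks-zero m y Y

  walks-last : ∀ L y → walks (suc L) y ≗ backStep (walks L y)
  walks-last zero y Y = cong₂ _+_ (delay1-walks-zero Y) (delay-walks-zero k′ y Y)
    where
    delay1-walks-zero : ∀ Y → walks 0 (suc y) Y ≡ delay 1 (walks 0 y) Y
    delay1-walks-zero zero    = refl
    delay1-walks-zero (suc Y) = refl
  walks-last (suc L) y Y = begin
    walks (suc L) (suc y) Y + delay k′ (λ z → walks (suc L) z Y) y
      ≡⟨ cong₂ _+_ (walks-last L (suc y) Y) (delay-cong k′ (λ z → walks-last L z Y) y) ⟩
    backStep (walks L (suc y)) Y + delay k′ (λ z → backStep (walks L z) Y) y
      ≡⟨ cong (_+_ (backStep (walks L (suc y)) Y)) (delay-+ k′ _ _ y) ⟩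
    (delay 1 (walks L (suc y)) Y + walks L (suc y) (Y + k′)) +
      (delay k′ (λ z → delay 1 (walks L z) Y) y + delay k′ (λ z → walks L z (Y + k′)) y)
      ≡⟨ ℕ+.interchange (delay 1 (walks L (suc y)) Y) (walks L (suc y) (Y + k′))
                        (delay k′ (λ z → delay 1 (walks L z) Y) y) (delay k′ (λ z → walks L z (Y + k′)) y) ⟩
    (delay 1 (walks L (suc y)) Y + delay k′ (λ z → delay 1 (walks L z) Y) y) + walks (suc L) y (Y + k′)
      ≡⟨ cong (_+ walks (suc L) y (Y + k′)) (delay1-walks Y) ⟩
    backStep (walks (suc L) y) Y
      ∎
    where
    delay1-walks : ∀ Y → delay 1 (walks L (suc y)) Y + delay k′ (λ z → delay 1 (walks L z) Y) y
                       ≡ delay 1 (walks (suc L) y) Y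
    delay1-walks zero    = delay-zero k′ y
    delay1-walks (suc Y) = refl

  walks-iterate : ∀ t L y → walks (t + L) y ≗ fold (walks L y) backStep t
  walks-iterate zero    L y Y = refl
  walks-iterate (suc t) L y Y = trans (walks-last (t + L) y Y) (backStep-cong (walks-iterate t L y) Y)

  backStep-iterate : ∀ t ψ Y → fold ψ backStep t (t + Y) ≡ binomialSum t (λ s → ψ (Y + s * suc k′))
  backStep-iterate zero    ψ Y = cong ψ (sym (ℕₚ.+-identityʳ Y))
  backStep-iterate (suc t) ψ Y = cong₂ _+_ (backStep-iterate t ψ Y) (begin
    fold ψ backStep t (suc (t + Y) + k′)                        ≡⟨ cong (fold ψ backStep t) (heights t Y) ⟩
    fold ψ backStep t (t + (Y + suc k′))                        ≡⟨ backStep-iterate t ψ (Y + suc k′) ⟩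
    binomialSum t (λ s → ψ (Y + suc k′ + s * suc k′))           ≡⟨ binomialSum-cong t (λ s → cong ψ (ℕₚ.+-assoc Y (suc k′) (s * suc k′))) ⟩
    binomialSum t (λ s → ψ (Y + suc s * suc k′))                ∎)
    where
    heights : ∀ t Y → suc (t + Y) + k′ ≡ t + (Y + suc k′)
    heights t Y = trans (sym (ℕₚ.+-suc (t + Y) k′)) (ℕₚ.+-assoc t Y (suc k′))

  walks-unreachable : ∀ L {y Y} → y + L < Y → walks L y Y ≡ 0
  walks-unreachable zero    {y} y+0<Y = walks-zero-< (subst (_< _) (ℕₚ.+-identityʳ y) y+0<Y)
  walks-unreachable (suc L) {y} {suc Y} y+1+L<1+Y = trans (walks-last L y (suc Y))
    (cong₂ _+_ (walks-unreachable L y+L<Y)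
               (walks-unreachable L (ℕₚ.<-≤-trans (ℕₚ.m<n⇒m<1+n y+L<Y) (ℕₚ.m≤m+n (suc Y) k′))))
    where
    y+L<Y : y + L < Y
    y+L<Y = ℕₚ.≤-pred (subst (_< suc Y) (ℕₚ.+-suc y L) y+1+L<1+Y)

-- The array of walk counts

module WalkArray (a c : ℕ) where
  open Walks (a + c) public

  k : ℕ
  k = suc (a + c)

  -- D^{k,a}_{n,m}, with heights measured from the floor y = −a
  entry : ℕ → ℕ → ℕ
  entry n m = walks (n * k) a (a + m * k)

  entry-above-diagonal : ∀ {i s} → i < s → entry i s ≡ 0
  entry-above-diagonal {i} i<s = walks-unreachable (i * k) (ℕₚ.+-monoʳ-< a (ℕₚ.*-monoˡ-< k i<s))

  sumTo-truncateRow : ∀ i j N (w : ℕ → ℤ) → i ≤ N →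
    sumTo (suc N) (λ s → w s ℤ.* + entry i (j + s)) ≡ sumTo (suc i) (λ s → w s ℤ.* + entry i (j + s))
  sumTo-truncateRow i j N w i≤N = sumTo-truncate _ (s≤s i≤N) (λ s i<s _ →
    trans (cong (λ x → w s ℤ.* + x) (entry-above-diagonal (ℕₚ.<-≤-trans i<s (ℕₚ.m≤n+m s j))))
          (ℤₚ.*-zeroʳ (w s)))

  entry-ASeq : IsASeq (λ n m → + entry n m) (binomial k)
  entry-ASeq i j = begin
    + walks (k + i * k) a (a + (k + j * k))
      ≡⟨ cong +_ (walks-iterate k (i * k) a _) ⟩
    + fold ψ backStep k (a + (k + j * k))
      ≡⟨ cong (λ Y → + fold ψ backStep k Y) (ℕ+.x∙yz≈y∙xz a k (j * k)) ⟩
    + fold ψ backStep k (k + (a + j * k))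
      ≡⟨ cong +_ (backStep-iterate k ψ (a + j * k)) ⟩
    + binomialSum k (λ s → ψ (a + j * k + s * k))
      ≡⟨ cong +_ (binomialSum-cong k (λ s → cong ψ (trans (ℕₚ.+-assoc a (j * k) (s * k))
                                                           (cong (_+_ a) (sym (ℕₚ.*-distribʳ-+ k j s)))))) ⟩
    + binomialSum k (λ s → entry i (j + s))
      ≡⟨ binomialSum-sumTo k _ (i + k) (ℕₚ.m≤n+m k i) ⟩
    sumTo (suc (i + k)) (λ s → binomial k s ℤ.* + entry i (j + s))
      ≡⟨ sumTo-truncateRow i j (i + k) (binomial k) (ℕₚ.m≤m+n i k) ⟩
    sumTo (suc i) (λ s → binomial k s ℤ.* + entry i (j + s))
      ∎
    where
    ψ : ℕ → ℕ
    ψ = walks (i * k) a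

  -- Near the floor the walks dipping below 0 are cut off; the hockey-stick identity
  -- collects what remains.
  backStep-iterate-floor : ∀ j ψ N → j + c ≤ N →
    + fold ψ backStep (suc (j + c)) j
      ≡ sumTo (suc N) (λ s → (binomial (suc (j + c)) (suc s) ℤ.- binomial c (suc s)) ℤ.* + ψ (a + s * k))
  backStep-iterate-floor zero ψ N c≤N = begin
    + fold ψ backStep c (a + c)
      ≡⟨ cong (λ Y → + fold ψ backStep c Y) (ℕₚ.+-comm a c) ⟩
    + fold ψ backStep c (c + a)
      ≡⟨ cong +_ (backStep-iterate c ψ a) ⟩
    + binomialSum c (λ s → ψ (a + s * k))
      ≡⟨ binomialSum-sumTo c _ N c≤N ⟩
    sumTo (suc N) (λ s → binomial c s ℤ.* + ψ (a + s * k))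
      ≡⟨ sumTo-cong (suc N) (λ s _ → cong (ℤ._* + ψ (a + s * k)) (pascal⁻ s)) ⟩
    sumTo (suc N) (λ s → (binomial (suc c) (suc s) ℤ.- binomial c (suc s)) ℤ.* + ψ (a + s * k))
      ∎
    where
    pascal⁻ : ∀ s → binomial c s ≡ binomial (suc c) (suc s) ℤ.- binomial c (suc s)
    pascal⁻ s = trans (sym (cancel (binomial c (suc s)) (binomial c s)))
                      (cong (ℤ._- binomial c (suc s)) (sym (binomial-pascal c s)))
      where
      cancel : ∀ p q → (p ℤ.+ q) ℤ.- p ≡ q
      cancel = solve-∀
  backStep-iterate-floor (suc j) ψ N 1+j+c≤N = begin
    + (fold ψ backStep (suc (j + c)) j + fold ψ backStep (suc (j + c)) (suc j + (a + c)))
      ≡⟨ ℤₚ.pos-+ (fold ψ backStep (suc (j + c)) j) _ ⟩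
    + fold ψ backStep (suc (j + c)) j ℤ.+ + fold ψ backStep (suc (j + c)) (suc j + (a + c))
      ≡⟨ cong₂ ℤ._+_ (backStep-iterate-floor j ψ N (ℕₚ.<⇒≤ 1+j+c≤N)) (cong +_ far) ⟩
    sumTo (suc N) (λ s → (binomial (suc (j + c)) (suc s) ℤ.- binomial c (suc s)) ℤ.* f s)
      ℤ.+ + binomialSum (suc (j + c)) (λ s → ψ (a + s * k))
      ≡⟨ cong (ℤ._+_ (sumTo (suc N) (λ s → (binomial (suc (j + c)) (suc s) ℤ.- binomial c (suc s)) ℤ.* f s)))
              (binomialSum-sumTo (suc (j + c)) _ N 1+j+c≤N) ⟩
    sumTo (suc N) (λ s → (binomial (suc (j + c)) (suc s) ℤ.- binomial c (suc s)) ℤ.* f s)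
      ℤ.+ sumTo (suc N) (λ s → binomial (suc (j + c)) s ℤ.* f s)
      ≡⟨ sym (sumTo-+ (suc N) _ _) ⟩
    sumTo (suc N) (λ s → (binomial (suc (j + c)) (suc s) ℤ.- binomial c (suc s)) ℤ.* f s
                           ℤ.+ binomial (suc (j + c)) s ℤ.* f s)
      ≡⟨ sumTo-cong (suc N) (λ s _ →
           trans (collect (binomial (suc (j + c)) (suc s)) (binomial c (suc s)) (binomial (suc (j + c)) s) (f s))
                 (cong (λ x → (x ℤ.- binomial c (suc s)) ℤ.* f s) (sym (binomial-pascal (suc (j + c)) s)))) ⟩
    sumTo (suc N) (λ s → (binomial (suc (suc j + c)) (suc s) ℤ.- binomial c (suc s)) ℤ.* f s)
      ∎
    where
    f : ℕ → ℤ
    f s = + ψ (a + s * k)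
    far : fold ψ backStep (suc (j + c)) (suc j + (a + c)) ≡ binomialSum (suc (j + c)) (λ s → ψ (a + s * k))
    far = trans (cong (fold ψ backStep (suc (j + c)))
                      (cong suc (trans (cong (_+_ j) (ℕₚ.+-comm a c)) (sym (ℕₚ.+-assoc j c a)))))
                (backStep-iterate (suc (j + c)) ψ a)
    collect : ∀ p q r x → (p ℤ.- q) ℤ.* x ℤ.+ r ℤ.* x ≡ ((p ℤ.+ r) ℤ.- q) ℤ.* x
    collect = solve-∀

  k∸a∸1≡c : k ∸ a ∸ 1 ≡ c
  k∸a∸1≡c = cong (_∸ 1) (trans (cong (_∸ a) (sym (ℕₚ.+-suc a c))) (ℕₚ.m+n∸m≡n a (suc c)))

  entry-ZSeq : IsZSeq (λ n m → + entry n m) (Zseq k a)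
  entry-ZSeq i = begin
    + walks (k + i * k) a (a + 0)
      ≡⟨ cong +_ (walks-iterate k (i * k) a (a + 0)) ⟩
    + fold ψ backStep k (a + 0)
      ≡⟨ cong (λ Y → + fold ψ backStep k Y) (ℕₚ.+-identityʳ a) ⟩
    + fold ψ backStep k a
      ≡⟨ backStep-iterate-floor a ψ (i + k) (ℕₚ.≤-trans (ℕₚ.n≤1+n (a + c)) (ℕₚ.m≤n+m k i)) ⟩
    sumTo (suc (i + k)) (λ s → (binomial k (suc s) ℤ.- binomial c (suc s)) ℤ.* + entry i s)
      ≡⟨ sumTo-truncateRow i 0 (i + k) (λ s → binomial k (suc s) ℤ.- binomial c (suc s)) (ℕₚ.m≤m+n i k) ⟩
    sumTo (suc i) (λ s → (binomial k (suc s) ℤ.- binomial c (suc s)) ℤ.* + entry i s)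
      ≡⟨ sumTo-cong (suc i) (λ s _ → cong (λ t → (binomial k (suc s) ℤ.- binomial t (suc s)) ℤ.* + entry i s)
                                          (sym k∸a∸1≡c)) ⟩
    sumTo (suc i) (λ s → Zseq k a s ℤ.* + entry i s)
      ∎
    where
    ψ : ℕ → ℕ
    ψ = walks (i * k) a

-- Counting step sequences

module _ {A : Set} where

  length-filterᵇ-++ : ∀ (p : A → Bool) xs ys →
    length (filterᵇ p (xs ++ ys)) ≡ length (filterᵇ p xs) + length (filterᵇ p ys)
  length-filterᵇ-++ p xs ys = trans (cong length (filter-++ (T? ∘ p) xs ys)) (length-++ (filterᵇ p xs))

  length-filterᵇ-∧ : ∀ b (p : A → Bool) xs →
    length (filterᵇ (λ x → b ∧ p x) xs) ≡ (if b then length (filterᵇ p xs) else 0)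
  length-filterᵇ-∧ true  p xs       = refl
  length-filterᵇ-∧ false p []       = refl
  length-filterᵇ-∧ false p (x ∷ xs) = length-filterᵇ-∧ false p xs

  length-filterᵇ-singleton : ∀ (p : A → Bool) x → length (filterᵇ p (x ∷ [])) ≡ (if p x then 1 else 0)
  length-filterᵇ-singleton p x with p x
  ... | true  = refl
  ... | false = refl

module _ {A B : Set} where

  length-filterᵇ-map : ∀ (p : B → Bool) (f : A → B) xs →
    length (filterᵇ p (map f xs)) ≡ length (filterᵇ (p ∘ f) xs)
  length-filterᵇ-map p f []       = refl
  length-filterᵇ-map p f (x ∷ xs) with p (f x)
  ... | true  = cong suc (length-filterᵇ-map p f xs)
  ... | false = length-filterᵇ-map p f xs

T-ext : ∀ {b c} → (T b → T c) → (T c → T b) → b ≡ c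
T-ext {false} {false} _ _ = refl
T-ext {false} {true}  _ f = ⊥-elim (f _)
T-ext {true}  {false} g _ = ⊥-elim (g _)
T-ext {true}  {true}  _ _ = refl

≤ᵇ∧≥ᵇ≡≟ : ∀ m n → ((m ≤ᵇ n) ∧ (n ≤ᵇ m)) ≡ does (m ≟ n)
≤ᵇ∧≥ᵇ≡≟ m n = T-ext
  (λ m≤n≥m → let (m≤n , n≤m) = Equivalence.to T-∧ m≤n≥m in
     ℕₚ.≡⇒≡ᵇ m n (ℕₚ.≤-antisym (ℕₚ.≤ᵇ⇒≤ m n m≤n) (ℕₚ.≤ᵇ⇒≤ n m n≤m)))
  (λ m≡n → Equivalence.from T-∧ (ℕₚ.≤⇒≤ᵇ (ℕₚ.≤-reflexive (ℕₚ.≡ᵇ⇒≡ m n m≡n)) ,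
                                  ℕₚ.≤⇒≤ᵇ (ℕₚ.≤-reflexive (sym (ℕₚ.≡ᵇ⇒≡ m n m≡n)))))

≤ᵇ-translate : ∀ i j x → (i ℤ.+ x ℤ.≤ᵇ j ℤ.+ x) ≡ (i ℤ.≤ᵇ j)
≤ᵇ-translate i j x = T-ext
  (λ i+x≤j+x → ℤₚ.≤⇒≤ᵇ (subst₂ ℤ._≤_ (cancel i x) (cancel j x)
                       (ℤₚ.+-monoˡ-≤ (ℤ.- x) (ℤₚ.≤ᵇ⇒≤ {i ℤ.+ x} {j ℤ.+ x} i+x≤j+x))))
  (λ i≤j → ℤₚ.≤⇒≤ᵇ (ℤₚ.+-monoˡ-≤ x (ℤₚ.≤ᵇ⇒≤ {i} {j} i≤j)))
  where
  cancel : ∀ i x → i ℤ.+ x ℤ.- x ≡ i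
  cancel = solve-∀

module PathCount (k′ a : ℕ) where
  open Walks k′

  private
    k : ℕ
    k = suc k′

  -- the height y above the floor is the height y − a of the paper
  ι : ℕ → ℤ
  ι y = + y ℤ.- + a

  count : ℕ → ℤ → ℤ → ℕ
  count L y Y = length (filterᵇ (validFrom k a y Y) (allSeqs L))

  aboveFloor : (ℤ → ℕ) → ℤ → ℕ
  aboveFloor g z = if ℤ.- + a ℤ.≤ᵇ z then g z else 0

  count-suc : ∀ L y Y → count (suc L) y Y ≡ aboveFloor (λ z → count L z Y) (y ℤ.+ δ k U)
                                           + aboveFloor (λ z → count L z Y) (y ℤ.+ δ k Dk)
  count-suc L y Y = trans (length-filterᵇ-++ V (map (U ∷_) xs) (map (Dk ∷_) xs))
    (cong₂ _+_ (firstStep U) (firstStep Dk))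
    where
    V : List Step → Bool
    V = validFrom k a y Y
    xs : List (List Step)
    xs = allSeqs L
    firstStep : ∀ s → length (filterᵇ V (map (s ∷_) xs)) ≡ aboveFloor (λ z → count L z Y) (y ℤ.+ δ k s)
    firstStep s = trans (length-filterᵇ-map V (s ∷_) xs)
                        (length-filterᵇ-∧ (ℤ.- + a ℤ.≤ᵇ y ℤ.+ δ k s) (validFrom k a (y ℤ.+ δ k s) Y) xs)

  ι-≤ᵇ : ∀ y Y → (ι y ℤ.≤ᵇ ι Y) ≡ (y ≤ᵇ Y)
  ι-≤ᵇ y Y = ≤ᵇ-translate (+ y) (+ Y) (ℤ.- + a)

  floor-≤ᵇ-ι : ∀ y → (ℤ.- + a ℤ.≤ᵇ ι y) ≡ true
  floor-≤ᵇ-ι y = trans (cong (ℤ._≤ᵇ ι y) (sym (ℤₚ.+-identityˡ (ℤ.- + a)))) (ι-≤ᵇ 0 y)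

  floor-≤ᵇ-below : ∀ m → (ℤ.- + a ℤ.≤ᵇ ι 0 ℤ.- + suc m) ≡ false
  floor-≤ᵇ-below m = trans (cong₂ ℤ._≤ᵇ_ (sym (ℤₚ.+-identityˡ (ℤ.- + a))) (reorder (+ suc m) (+ a)))
                           (≤ᵇ-translate 0ℤ (ℤ.- + suc m) (ℤ.- + a))
    where
    reorder : ∀ x y → 0ℤ ℤ.- y ℤ.- x ≡ ℤ.- x ℤ.+ ℤ.- y
    reorder = solve-∀

  ι-up : ∀ y → ι y ℤ.+ δ k U ≡ ι (suc y)
  ι-up y = sym (trans (cong (ℤ._- + a) (ℤₚ.pos-+ 1 y)) (reorder (+ y) (+ a)))
    where
    reorder : ∀ y x → 1ℤ ℤ.+ y ℤ.- x ≡ y ℤ.- x ℤ.+ 1ℤ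
    reorder = solve-∀

  ι-down : ∀ y → ι y ℤ.+ δ k Dk ≡ ι y ℤ.- + k′
  ι-down y = trans (cong (λ v → ι y ℤ.+ (1ℤ ℤ.- v)) (ℤₚ.pos-+ 1 k′)) (reorder (ι y) (+ k′))
    where
    reorder : ∀ z x → z ℤ.+ (1ℤ ℤ.- (1ℤ ℤ.+ x)) ≡ z ℤ.- x
    reorder = solve-∀

  ι-suc-minus : ∀ y m → ι (suc y) ℤ.- + suc m ≡ ι y ℤ.- + m
  ι-suc-minus y m = trans (cong₂ (λ u v → u ℤ.- + a ℤ.- v) (ℤₚ.pos-+ 1 y) (ℤₚ.pos-+ 1 m))
                          (reorder (+ y) (+ a) (+ m))
    where
    reorder : ∀ y x m → 1ℤ ℤ.+ y ℤ.- x ℤ.- (1ℤ ℤ.+ m) ≡ y ℤ.- x ℤ.- m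
    reorder = solve-∀

  aboveFloor-delay : ∀ g m y → aboveFloor g (ι y ℤ.- + m) ≡ delay m (g ∘ ι) y
  aboveFloor-delay g zero y =
    trans (cong (aboveFloor g) (ℤₚ.+-identityʳ (ι y)))
          (cong (λ b → if b then g (ι y) else 0) (floor-≤ᵇ-ι y))
  aboveFloor-delay g (suc m) zero    = cong (λ b → if b then g (ι 0 ℤ.- + suc m) else 0) (floor-≤ᵇ-below m)
  aboveFloor-delay g (suc m) (suc y) = trans (cong (aboveFloor g) (ι-suc-minus y m)) (aboveFloor-delay g m y)

  count-walks : ∀ L y Y → count L (ι y) (ι Y) ≡ walks L y Y
  count-walks zero y Y = trans (length-filterᵇ-singleton (validFrom k a (ι y) (ι Y)) [])
    (cong (λ b → if b then 1 else 0) (trans (cong₂ _∧_ (ι-≤ᵇ y Y) (ι-≤ᵇ Y y)) (≤ᵇ∧≥ᵇ≡≟ y Y)))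
  count-walks (suc L) y Y = begin
    count (suc L) (ι y) (ι Y)
      ≡⟨ count-suc L (ι y) (ι Y) ⟩
    aboveFloor G (ι y ℤ.+ δ k U) + aboveFloor G (ι y ℤ.+ δ k Dk)
      ≡⟨ cong₂ _+_ (trans (cong (aboveFloor G) (ι-up y))
                          (cong (λ b → if b then G (ι (suc y)) else 0) (floor-≤ᵇ-ι (suc y))))
                   (trans (cong (aboveFloor G) (ι-down y)) (aboveFloor-delay G k′ y)) ⟩
    G (ι (suc y)) + delay k′ (G ∘ ι) y
      ≡⟨ cong₂ _+_ (count-walks L (suc y) Y) (delay-cong k′ (λ z → count-walks L z Y) y) ⟩
    walks (suc L) y Y
      ∎
    where
    G : ℤ → ℕ
    G z = count L z (ι Y)

  Dyck-walks : ∀ n m → Dyck k a n m ≡ walks (k * n) a (a + k * m)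
  Dyck-walks n m = trans (cong₂ (count (k * n)) (sym (ℤₚ.+-inverseʳ (+ a))) (sym ι-a+))
                         (count-walks (k * n) a (a + k * m))
    where
    ι-a+ : ι (a + k * m) ≡ + (k * m)
    ι-a+ = trans (cong (ℤ._- + a) (ℤₚ.pos-+ a (k * m))) (cancel (+ a) (+ (k * m)))
      where
      cancel : ∀ x y → x ℤ.+ y ℤ.- x ≡ y
      cancel = solve-∀

DyckRiordan : ℕ → ℕ → Set
DyckRiordan k a = Σ FPS (λ d → Σ FPS (λ h →
  IsProper d h
  × (∀ n m → m ≤ n → + (Dyck k a n m) ≡ riordan d h n m)
  × IsASeq (riordan d h) (Aseq k)
  × IsZSeq (riordan d h) (Zseq k a)))

dyckRiordan : ∀ a c → DyckRiordan (suc (a + c)) a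
dyckRiordan a c = d , h , (d0≢0 , h≗tA[h] 0 , h1≢0) , dyck , riordan-ASeq A d h h≗tA[h] , zseq
  where
  open WalkArray a c
  open PathCount (a + c) a using (Dyck-walks)

  A : FPS
  A = Aseq k
  d : FPS
  d n = + entry n 0
  h : FPS
  h = lagrange A
  h≗tA[h] : h ≗ shift (A ∘ˢ h)
  h≗tA[h] = lagrange-unfold A

  riordan-entry : ∀ n m → riordan d h n m ≡ + entry n m
  riordan-entry = ASeq-unique A (riordan-ASeq A d h h≗tA[h]) entry-ASeq (⊛-identityʳ d)
    (λ m → trans (riordan-above-diagonal d {h} (h≗tA[h] 0) {0} {suc m} (s≤s z≤n))
                 (cong +_ (sym (entry-above-diagonal {0} {suc m} (s≤s z≤n)))))

  d0≡1 : d 0 ≡ 1ℤ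
  d0≡1 = cong +_ (trans (cong (walks 0 a) (ℕₚ.+-identityʳ a)) (walks-zero-refl a))

  d0≢0 : d 0 ≢ 0ℤ
  d0≢0 d0≡0 with () ← trans (sym d0≡1) d0≡0

  h1≡1 : h 1 ≡ 1ℤ
  h1≡1 = trans (h≗tA[h] 1) (trans (ℤₚ.+-identityˡ _) (trans (ℤₚ.*-identityʳ (A 0)) (binomial-zero k)))

  h1≢0 : h 1 ≢ 0ℤ
  h1≢0 h1≡0 with () ← trans (sym h1≡1) h1≡0

  dyck : ∀ n m → m ≤ n → + Dyck k a n m ≡ riordan d h n m
  dyck n m _ = begin
    + Dyck k a n m                       ≡⟨ cong +_ (Dyck-walks n m) ⟩
    + walks (k * n) a (a + k * m)        ≡⟨ cong₂ (λ x y → + walks x a (a + y)) (ℕₚ.*-comm k n) (ℕₚ.*-comm k m) ⟩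
    + entry n m                          ≡⟨ sym (riordan-entry n m) ⟩
    riordan d h n m                      ∎

  zseq : IsZSeq (riordan d h) (Zseq k a)
  zseq i = trans (riordan-entry (suc i) 0) (trans (entry-ZSeq i)
    (sumTo-cong (suc i) (λ r _ → cong (Zseq k a r ℤ.*_) (sym (riordan-entry i r)))))

theorem3p1 : (k a : ℕ) → 2 ≤ k → a ≤ k ∸ 1 →
    Σ FPS (λ d → Σ FPS (λ h →
      IsProper d h
      × (∀ n m → m ≤ n → + (Dyck k a n m) ≡ riordan d h n m)
      × IsASeq (riordan d h) (Aseq k)
      × IsZSeq (riordan d h) (Zseq k a)))
theorem3p1 zero    a ()
theorem3p1 (suc k′) a _ a≤k′ with ℕₚ.m≤n⇒∃[o]m+o≡n a≤k′
... | c , refl = dyckRiordan a c
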